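{- Let $n\ge1$ and $R_i$ be as in the context. Then $R_{ -n-1}\subseteq R_{ -n}\subseteq\cdots\subseteq R_{ -1}\subseteq R_0\subseteq R_1\subseteq\cdots\subseteq R_n\subseteq R_{n+1}$.
   Context: For $p=(p_1,\dots,p_n)\in\mathbb Q^n$: $(p,q)\in L_1$ iff $p_1<q_1$; for $2\le i\le n$, $(p,q)\in L_i$ iff $(p_1,\dots,p_{i-1})=(q_1,\dots,q_{i-1})$ and $p_i<q_i$. Let $<_n=L_1\cup\dots\cup L_n$. $X=\mathbb Q^n\times\{ -1,1\}$, writing $p^b$ for $(p,b)$, with $p^b\le_X q^d$ iff $p^b=q^d$ or $p<_nq$; $\alpha(p^b)=p^{ -b}$. For $R\subseteq X^2$, $R^c=X^2\setminus R$, $R^\smile$ the converse, $\circ$ relational composition. $U_j=\{(p^b,q^d)\mid b,d\in\{ -1,1\},(p,q)\in L_j\}$. $R_{ -n-1}=\varnothing$; $R_i=\bigcup_{j=1}^{n+1+i}U_j$ for $-n\le i\le-1$; $R_0={\le_X}$; $R_i=(R_{ -i})^{c\smile}\circ\alpha$ for $1\le i\le n+1$. -}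

module Defs where

open import Data.Nat as ℕ using (ℕ; zero; suc)
open import Data.Nat.Properties as ℕP using ()
open import Data.Fin using (Fin; toℕ)
open import Data.Vec using (Vec; lookup)
open import Data.Rational as ℚ using (ℚ)
open import Data.Sign using (Sign; opposite)
open import Data.Integer as ℤ using (ℤ; +_; -[1+_])
open import Data.Product using (Σ; ∃; _×_; _,_)
open import Data.Sum using (_⊎_)
open import Data.Empty using (⊥)
open import Relation.Nullary using (¬_; Dec; yes; no)
open import Relation.Binary.PropositionalEquality using (_≡_)

Qn : ℕ → Set
Qn n = Vec ℚ n

-- L_j, with j given 0-indexed as a Fin n (so paper's L_{toℕ j + 1}):
-- coordinates before j agree and the j-th coordinate is strictly smaller.
L : (n : ℕ) → Fin n → Qn n → Qn n → Set
L n j p q = (∀ (k : Fin n) → toℕ k ℕ.< toℕ j → lookup p k ≡ lookup q k)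
          × (lookup p j ℚ.< lookup q j)

_<ₙ_ : {n : ℕ} → Qn n → Qn n → Set
_<ₙ_ {n} p q = ∃ λ (j : Fin n) → L n j p q

-- X = ℚ^n × {-1,1}; signs represented by Data.Sign (- for -1, + for 1)
X : ℕ → Set
X n = Qn n × Sign

Rel : ℕ → Set₁
Rel n = X n → X n → Set

≤X : (n : ℕ) → Rel n
≤X n (p , b) (q , d) = ((p , b) ≡ (q , d)) ⊎ (p <ₙ q)

α : (n : ℕ) → X n → X n
α n (p , b) = (p , opposite b)

U : (n : ℕ) → Fin n → Rel n
U n j (p , b) (q , d) = L n j p q

_ᶜ : {n : ℕ} → Rel n → Rel n
(R ᶜ) x y = ¬ R x y

_˘ : {n : ℕ} → Rel n → Rel n
(R ˘) x y = R y x

_⨾_ : {n : ℕ} → Rel n → Rel n → Rel n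
(R ⨾ S) x z = ∃ λ y → R x y × S y z

αRel : (n : ℕ) → Rel n
αRel n x y = y ≡ α n x

∅ : (n : ℕ) → Rel n
∅ n x y = ⊥

-- R_{-(k+1)} for 0 ≤ k ≤ n: empty if k = n (i.e. R_{-n-1}),
-- otherwise ⋃_{j=1}^{n+1+i} U_j with i = -(k+1), i.e. paper-indices j ≤ n - k,
-- i.e. 0-indexed toℕ j + 1 ≤ n - k, i.e. toℕ j + k < n.
Rneg-aux : (n k : ℕ) → Dec (k ≡ n) → Rel n
Rneg-aux n k (yes _) = ∅ n
Rneg-aux n k (no _) x y = ∃ λ (j : Fin n) → (toℕ j ℕ.+ k ℕ.< n) × U n j x y

Rneg : (n k : ℕ) → Rel n
Rneg n k = Rneg-aux n k (k ℕP.≟ n)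

-- R_i for integer i (only meaningful for -n-1 ≤ i ≤ n+1)
-- R_0 = ≤X; R_{-(k+1)} = Rneg n k; R_{k+1} = (R_{-(k+1)})^{c˘} ∘ α
R : (n : ℕ) → ℤ → Rel n
R n (+ zero)    = ≤X n
R n -[1+ k ]    = Rneg n k
R n (+ (suc k)) = (((Rneg n k) ᶜ) ˘) ⨾ αRel n

_⊆_ : {n : ℕ} → Rel n → Rel n → Set
R₁ ⊆ R₂ = ∀ x y → R₁ x y → R₂ x y

{-# OPTIONS --safe #-}
module Submission where

open import Defs
open import Data.Nat using (ℕ; suc; _≥_)
open import Data.Integer using (ℤ; +_; -[1+_]; _≤_; _<_; _+_; 1ℤ)
open import Data.Integer.Base using (-≤-; +<+)
import Data.Nat as ℕ
import Data.Nat.Properties as ℕP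
import Data.Rational.Properties as ℚP
open import Data.Sign.Properties using (opposite-involutive)
open import Data.Fin using (toℕ)
open import Data.Fin.Properties using (toℕ-injective)
open import Data.Product using (_,_; proj₁)
open import Data.Sum using (inj₁; inj₂)
open import Data.Empty using (⊥-elim)
open import Relation.Nullary using (¬_; yes; no)
open import Relation.Binary.PropositionalEquality using (_≡_; refl; sym; cong)
open import Relation.Binary.Definitions using (tri<; tri≈; tri>)

-- For i ≤ 0 the relations R_i only compare points, by <ₙ, and shrink as levels L_j are
-- dropped. The positive half is the image of the negative half under the order-reversing
-- map S ↦ Sᶜ˘ ⨾ α, and R_0 ⊆ R_1 holds because ≤_X is disjoint from the converse of <ₙ,
-- the levels L_j being irreflexive and pairwise asymmetric.

<ₙ-irrefl : ∀ {n} (p : Qn n) → ¬ (p <ₙ p)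
<ₙ-irrefl p (j , _ , pⱼ<pⱼ) = ℚP.<-irrefl refl pⱼ<pⱼ

<ₙ-asym : ∀ {n} {p q : Qn n} → p <ₙ q → ¬ (q <ₙ p)
<ₙ-asym (j , p≡q , p<q) (j′ , q≡p , q<p) with ℕP.<-cmp (toℕ j) (toℕ j′)
... | tri< j<j′ _ _ = ℚP.<-irrefl (sym (q≡p j j<j′)) p<q
... | tri> _ _ j′<j = ℚP.<-irrefl (sym (p≡q j′ j′<j)) q<p
... | tri≈ _ j≡j′ _ with toℕ-injective {i = j} {j = j′} j≡j′
...   | refl = ℚP.<-asym p<q q<p

≤X⇒≯ : ∀ {n} {x z : X n} → ≤X n x z → ¬ (proj₁ z <ₙ proj₁ x)
≤X⇒≯ {x = p , _} (inj₁ refl) = <ₙ-irrefl p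
≤X⇒≯ {x = p , _} {z = q , _} (inj₂ p<q) = <ₙ-asym {p = p} {q = q} p<q

Rneg-aux⇒<ₙ : ∀ n k d {x y : X n} → Rneg-aux n k d x y → proj₁ x <ₙ proj₁ y
Rneg-aux⇒<ₙ n k (no _) (j , _ , pLq) = j , pLq

Rneg⇒<ₙ : ∀ n k {x y : X n} → Rneg n k x y → proj₁ x <ₙ proj₁ y
Rneg⇒<ₙ n k = Rneg-aux⇒<ₙ n k (k ℕP.≟ n)

Rneg-aux-antitone : ∀ n k → k ℕ.< n → ∀ d′ d →
  _⊆_ {n} (Rneg-aux n (suc k) d′) (Rneg-aux n k d)
Rneg-aux-antitone n k k<n (yes _) _       _ _ ()
Rneg-aux-antitone n k k<n (no _)  (yes k≡n) _ _ _ = ⊥-elim (ℕP.<-irrefl k≡n k<n)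
Rneg-aux-antitone n k k<n (no _)  (no _)  _ _ (j , j+1+k<n , u) =
  j , ℕP.<-trans (ℕP.+-monoʳ-< (toℕ j) (ℕP.n<1+n k)) j+1+k<n , u

Rneg-antitone : ∀ n k → k ℕ.< n → _⊆_ {n} (Rneg n (suc k)) (Rneg n k)
Rneg-antitone n k k<n = Rneg-aux-antitone n k k<n (suc k ℕP.≟ n) (k ℕP.≟ n)

Rneg-zero⊆≤X : ∀ n → _⊆_ {n} (Rneg n 0) (≤X n)
Rneg-zero⊆≤X n _ _ r = inj₂ (Rneg⇒<ₙ n 0 r)

α-involutive : ∀ n (x : X n) → α n (α n x) ≡ x
α-involutive n (p , b) = cong (p ,_) (opposite-involutive b)

≤X⊆R₁ : ∀ n → _⊆_ {n} (≤X n) (R n (+ 1))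
≤X⊆R₁ n x z x≤z =
  α n z , (λ r → ≤X⇒≯ x≤z (Rneg⇒<ₙ n 0 r)) , sym (α-involutive n z)

ᶜ˘⨾-antitone : ∀ {n} {S T : Rel n} (A : Rel n) → S ⊆ T → (((T ᶜ) ˘) ⨾ A) ⊆ (((S ᶜ) ˘) ⨾ A)
ᶜ˘⨾-antitone A S⊆T x z (y , ¬Tyx , yAz) = y , (λ Syx → ¬Tyx (S⊆T y x Syx)) , yAz

lemma3p5 : (n : ℕ) → n ≥ 1 → (i : ℤ) → -[1+ n ] ≤ i → i < + (suc n) →
    _⊆_ {n} (R n i) (R n (i + 1ℤ))
lemma3p5 n _ -[1+ 0 ]     _            _ = Rneg-zero⊆≤X n
lemma3p5 n _ -[1+ suc k ] (-≤- 1+k≤n)  _ = Rneg-antitone n k 1+k≤n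
lemma3p5 n _ (+ 0)        _            _ = ≤X⊆R₁ n
lemma3p5 n _ (+ suc k)    _ (+<+ (ℕ.s≤s k<n)) rewrite ℕP.+-comm k 1 =
  ᶜ˘⨾-antitone (αRel n) (Rneg-antitone n k k<n)
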